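{- Let $p$ be an odd prime, let $v$ be an integral vector each of whose entries is nonzero modulo $p$, and let $c_1,c_2$ be two distinct integers in $\{1,2,\ldots,p-1\}$. Then: (i) any two distinct perfect $p$-representatives $u_1,u_2$ of $c_1v$ are orthogonal in $\mathbb{R}^n$; (ii) any perfect $p$-representative $w_1$ of $c_1v$ and any perfect $p$-representative $w_2$ of $c_2v$ are distinct and orthogonal in $\mathbb{R}^n$.
   Context: Here $v$ is $n$-dimensional and $e$ is the all-one vector. For integral vectors $v,w$, $w$ is a perfect $p$-representative of $v$ if $w\equiv v\pmod p$, $w^{\mathrm T}e=p$ and $w^{\mathrm T}w=p^2$. -}

module Defs where

open import Data.Nat using (ℕ)
open import Data.Integer using (ℤ; +_; _+_; _*_; _-_)
open import Data.Integer.Divisibility using (_∣_)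
open import Data.Vec using (Vec; zipWith; foldr; map; replicate)
open import Data.Vec.Relation.Unary.All using (All)
open import Data.Vec.Relation.Binary.Pointwise.Inductive using (Pointwise)
open import Relation.Binary.PropositionalEquality using (_≡_)
open import Relation.Nullary using (¬_)

dot : ∀ {n} → Vec ℤ n → Vec ℤ n → ℤ
dot x y = foldr _ _+_ (+ 0) (zipWith _*_ x y)

ones : ∀ n → Vec ℤ n
ones n = replicate n (+ 1)

scale : ∀ {n} → ℤ → Vec ℤ n → Vec ℤ n
scale c v = map (c *_) v

_≡_[mod_] : ℤ → ℤ → ℕ → Set
a ≡ b [mod p ] = (+ p) ∣ (a - b)

VecCong : ∀ {n} → ℕ → Vec ℤ n → Vec ℤ n → Set
VecCong p w v = Pointwise (λ a b → a ≡ b [mod p ]) w v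

PerfectRep : ∀ {n} → ℕ → Vec ℤ n → Vec ℤ n → Set
PerfectRep {n} p v w =
  VecCong p w v × (dot w (ones n) ≡ + p) × (dot w w ≡ + (p Data.Nat.* p))
  where open import Data.Product using (_×_)

EntriesNonzeroMod : ∀ {n} → ℕ → Vec ℤ n → Set
EntriesNonzeroMod p v = All (λ a → ¬ ((+ p) ∣ a)) v

-- Let u, w be perfect p-representatives of c₁v and c₂v, and K = u·w.  The vector
-- c₂u − c₁w vanishes modulo p, so p² divides its squared norm c₂²p² − 2c₁c₂K + c₁²p²,
-- hence p² ∣ 2c₁c₂K and, p being odd and c₁, c₂ units, p² ∣ K.  Since u and w both have
-- squared norm p², the equality case of Cauchy–Schwarz leaves only K = 0, u = w or
-- u = −w; the last contradicts u·e = w·e = p.  Distinctness when c₁ ≠ c₂ holds already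
-- entrywise: c₁x ≢ c₂x (mod p) for every entry x of v.
module Submission where

open import Data.Integer using (ℤ; +_; +[1+_]; -[1+_]; _+_; _*_; _-_; -_; ∣_∣)
import Data.Integer as ℤ
import Data.Integer.Properties as ℤ
open import Data.Integer.Divisibility.Signed
  using (_∣_; divides; ∣ᵤ⇒∣; ∣⇒∣ᵤ; ∣m∣n⇒∣m+n; ∣m∣n⇒∣m-n; ∣n⇒∣m*n; ∣-refl)
open import Data.Integer.Tactic.RingSolver using (solve-∀)
open import Data.Nat using (ℕ; zero; suc; _<_; _≤_; z≤n; s≤s)
import Data.Nat as ℕ
import Data.Nat.Properties as ℕ
open import Data.Nat.Divisibility as ℕ∣ using () renaming (_∣_ to _∣ₙ_)
open import Data.Nat.Primality using (Prime; euclidsLemma; prime⇒nonZero; prime⇒nonTrivial)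
open import Data.Product using (_×_; _,_)
open import Data.Sum as Sum using (_⊎_; inj₁; inj₂; [_,_]′)
open import Data.Vec using (Vec; []; _∷_; zipWith)
open import Data.Vec.Relation.Unary.All using (All; []; _∷_)
open import Data.Vec.Relation.Binary.Pointwise.Inductive using ([]; _∷_)
open import Function using (id; flip; _∘_)
open import Relation.Binary.PropositionalEquality
open import Relation.Nullary using (¬_; contradiction)

open import Defs

linComb : ∀ {n} → ℤ → ℤ → Vec ℤ n → Vec ℤ n → Vec ℤ n
linComb a b = zipWith (λ x y → a * x + b * y)

dot-linCombˡ : ∀ {n} a b (u w z : Vec ℤ n) →
  dot (linComb a b u w) z ≡ a * dot u z + b * dot w z
dot-linCombˡ a b [] [] [] = sym (cong₂ _+_ (ℤ.*-zeroʳ a) (ℤ.*-zeroʳ b))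
dot-linCombˡ a b (x ∷ u) (y ∷ w) (t ∷ z) =
  trans (cong (_+_ ((a * x + b * y) * t)) (dot-linCombˡ a b u w z))
        (regroup a b x y t (dot u z) (dot w z))
  where
  regroup : ∀ a b x y t U W → (a * x + b * y) * t + (a * U + b * W) ≡ a * (x * t + U) + b * (y * t + W)
  regroup = solve-∀

dot-linComb-self : ∀ {n} a b (u w : Vec ℤ n) →
  dot (linComb a b u w) (linComb a b u w) ≡ a * a * dot u u + + 2 * a * b * dot u w + b * b * dot w w
dot-linComb-self a b [] [] = nil a b
  where
  nil : ∀ a b → + 0 ≡ a * a * + 0 + + 2 * a * b * + 0 + b * b * + 0
  nil = solve-∀
dot-linComb-self a b (x ∷ u) (y ∷ w) =
  trans (cong (_+_ ((a * x + b * y) * (a * x + b * y))) (dot-linComb-self a b u w))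
        (regroup a b x y (dot u u) (dot u w) (dot w w))
  where
  regroup : ∀ a b x y U V W →
    (a * x + b * y) * (a * x + b * y) + (a * a * U + + 2 * a * b * V + b * b * W)
      ≡ a * a * (x * x + U) + + 2 * a * b * (x * y + V) + b * b * (y * y + W)
  regroup = solve-∀

dot-zeroˡ : ∀ {n} {z : Vec ℤ n} → All (_≡ + 0) z → (y : Vec ℤ n) → dot z y ≡ + 0
dot-zeroˡ [] [] = refl
dot-zeroˡ (refl ∷ zs) (_ ∷ y) = trans (ℤ.+-identityˡ _) (dot-zeroˡ zs y)

sumOfSquares : ∀ {n} → Vec ℤ n → ℕ
sumOfSquares [] = 0
sumOfSquares (x ∷ z) = ∣ x ∣ ℕ.* ∣ x ∣ ℕ.+ sumOfSquares z

dot-self≡sumOfSquares : ∀ {n} (z : Vec ℤ n) → dot z z ≡ + sumOfSquares z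
dot-self≡sumOfSquares [] = refl
dot-self≡sumOfSquares (x ∷ z) = cong₂ _+_ (square x) (dot-self≡sumOfSquares z)
  where
  square : ∀ x → x * x ≡ + (∣ x ∣ ℕ.* ∣ x ∣)
  square (+ n) = sym (ℤ.pos-* n n)
  square -[1+ n ] = refl

sumOfSquares≡0⇒zero : ∀ {n} (z : Vec ℤ n) → sumOfSquares z ≡ 0 → All (_≡ + 0) z
sumOfSquares≡0⇒zero [] _ = []
sumOfSquares≡0⇒zero (x ∷ z) s≡0 =
  ℤ.∣i∣≡0⇒i≡0 ([ id , id ]′ (ℕ.m*n≡0⇒m≡0∨n≡0 ∣ x ∣ (ℕ.m+n≡0⇒m≡0 _ s≡0)))
  ∷ sumOfSquares≡0⇒zero z (ℕ.m+n≡0⇒n≡0 (∣ x ∣ ℕ.* ∣ x ∣) s≡0)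

dot-self≤0⇒zero : ∀ {n} (z : Vec ℤ n) → dot z z ℤ.≤ + 0 → All (_≡ + 0) z
dot-self≤0⇒zero z zz≤0 =
  sumOfSquares≡0⇒zero z (ℕ.n≤0⇒n≡0 (ℤ.drop‿+≤+ (subst (ℤ._≤ + 0) (dot-self≡sumOfSquares z) zz≤0)))

linComb-sub-zero⇒≡ : ∀ {n} (u w : Vec ℤ n) → All (_≡ + 0) (linComb (+ 1) (- + 1) u w) → u ≡ w
linComb-sub-zero⇒≡ [] [] [] = refl
linComb-sub-zero⇒≡ (x ∷ u) (y ∷ w) (x-y≡0 ∷ rest) =
  cong₂ _∷_ (trans (split x y) (trans (cong (_+ y) x-y≡0) (ℤ.+-identityˡ y)))
            (linComb-sub-zero⇒≡ u w rest)
  where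
  split : ∀ x y → x ≡ (+ 1 * x + - + 1 * y) + y
  split = solve-∀

-- Equality case of Cauchy–Schwarz for vectors of equal norm: ‖u + b w‖² = 2 (N + b (u·w)).
equalNorms-N+b*dot≤0⇒zero : ∀ {n N} b (u w : Vec ℤ n) → b * b ≡ + 1 →
  dot u u ≡ N → dot w w ≡ N → N + b * dot u w ℤ.≤ + 0 → All (_≡ + 0) (linComb (+ 1) b u w)
equalNorms-N+b*dot≤0⇒zero {N = N} b u w b²≡1 uu≡N ww≡N N+bK≤0 = dot-self≤0⇒zero _ (begin
  dot (linComb (+ 1) b u w) (linComb (+ 1) b u w)                  ≡⟨ dot-linComb-self (+ 1) b u w ⟩
  + 1 * + 1 * dot u u + + 2 * + 1 * b * dot u w + b * b * dot w w  ≡⟨ insert-norms uu≡N b²≡1 ww≡N ⟩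
  + 1 * + 1 * N + + 2 * + 1 * b * dot u w + + 1 * N                 ≡⟨ collect N b (dot u w) ⟩
  + 2 * (N + b * dot u w)                                          ≤⟨ ℤ.*-monoˡ-≤-nonNeg (+ 2) N+bK≤0 ⟩
  + 2 * + 0                                                         ≡⟨⟩
  + 0                                                               ∎)
  where
  open ℤ.≤-Reasoning
  insert-norms : ∀ {U B W} → U ≡ N → B ≡ + 1 → W ≡ N →
    + 1 * + 1 * U + + 2 * + 1 * b * dot u w + B * W ≡ + 1 * + 1 * N + + 2 * + 1 * b * dot u w + + 1 * N
  insert-norms refl refl refl = refl
  collect : ∀ N b K → + 1 * + 1 * N + + 2 * + 1 * b * K + + 1 * N ≡ + 2 * (N + b * K)
  collect = solve-∀

N≤[1+m]*N : ∀ N m → + N ℤ.≤ +[1+ m ] * + N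
N≤[1+m]*N N m = subst (+ N ℤ.≤_) (ℤ.pos-* (suc m) N) (ℤ.+≤+ (ℕ.m≤m+n N (m ℕ.* N)))

-- The quotient (u·w)/N is 0, positive (forcing u = w) or negative (forcing u + w = 0).
equalNorms-∣dot⇒orthogonal⊎equal⊎opposite : ∀ {n} N (u w : Vec ℤ n) →
  dot u u ≡ + N → dot w w ≡ + N → + N ∣ dot u w →
  dot u w ≡ + 0 ⊎ u ≡ w ⊎ All (_≡ + 0) (linComb (+ 1) (+ 1) u w)
equalNorms-∣dot⇒orthogonal⊎equal⊎opposite N u w uu ww (divides (+ 0) K≡0) = inj₁ K≡0
equalNorms-∣dot⇒orthogonal⊎equal⊎opposite N u w uu ww (divides +[1+ m ] K≡) =
  inj₂ (inj₁ (linComb-sub-zero⇒≡ u w (equalNorms-N+b*dot≤0⇒zero (- + 1) u w refl uu ww N-K≤0)))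
  where
  N-K≤0 : + N + - + 1 * dot u w ℤ.≤ + 0
  N-K≤0 = subst (λ t → + N + t ℤ.≤ + 0) (sym (ℤ.-1*i≡-i (dot u w)))
            (ℤ.i≤j⇒i-j≤0 (subst (+ N ℤ.≤_) (sym K≡) (N≤[1+m]*N N m)))
equalNorms-∣dot⇒orthogonal⊎equal⊎opposite N u w uu ww (divides -[1+ m ] K≡) =
  inj₂ (inj₂ (equalNorms-N+b*dot≤0⇒zero (+ 1) u w refl uu ww N+K≤0))
  where
  K≤-N : dot u w ℤ.≤ - + N
  K≤-N = subst (ℤ._≤ - + N) (trans (ℤ.neg-distribˡ-* +[1+ m ] (+ N)) (sym K≡))
           (ℤ.neg-mono-≤ (N≤[1+m]*N N m))
  N+K≤0 : + N + + 1 * dot u w ℤ.≤ + 0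
  N+K≤0 = subst (λ t → + N + t ℤ.≤ + 0) (sym (ℤ.*-identityˡ (dot u w)))
            (subst (+ N + dot u w ℤ.≤_) (ℤ.+-inverseʳ (+ N)) (ℤ.+-monoʳ-≤ (+ N) K≤-N))

∤-below : ∀ {p d} → 1 ≤ d → d < p → ¬ p ∣ₙ d
∤-below 1≤d d<p = ℕ∣.>⇒∤ {{ℕ.>-nonZero 1≤d}} d<p

prime∤* : ∀ {p m n} → Prime p → ¬ p ∣ₙ m → ¬ p ∣ₙ n → ¬ p ∣ₙ m ℕ.* n
prime∤* pr p∤m p∤n p∣mn = [ p∤m , p∤n ]′ (euclidsLemma _ _ pr p∣mn)

p*p∣m*n⇒p*p∣n : ∀ {p m n} → Prime p → ¬ p ∣ₙ m → p ℕ.* p ∣ₙ m ℕ.* n → p ℕ.* p ∣ₙ n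
p*p∣m*n⇒p*p∣n {p} {m} {n} pr p∤m pp∣mn
  with euclidsLemma m n pr (ℕ∣.∣-trans (ℕ∣.m∣m*n p) pp∣mn)
... | inj₁ p∣m = contradiction p∣m p∤m
... | inj₂ (ℕ∣.divides k refl) = ℕ∣.*-monoˡ-∣ p p∣k
  where
  p∣m*k : p ∣ₙ m ℕ.* k
  p∣m*k = ℕ∣.*-cancelʳ-∣ p {{prime⇒nonZero pr}} (subst (p ℕ.* p ∣ₙ_) (sym (ℕ.*-assoc m k p)) pp∣mn)
  p∣k : p ∣ₙ k
  p∣k = [ flip contradiction p∤m , id ]′ (euclidsLemma m k pr p∣m*k)

euclidsLemma-ℤ : ∀ {p} i j → Prime p → + p ∣ i * j → (+ p ∣ i) ⊎ (+ p ∣ j)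
euclidsLemma-ℤ {p} i j pr p∣ij =
  Sum.map ∣ᵤ⇒∣ ∣ᵤ⇒∣ (euclidsLemma ∣ i ∣ ∣ j ∣ pr (subst (p ∣ₙ_) (ℤ.abs-* i j) (∣⇒∣ᵤ p∣ij)))

p∣m-n⇒m≡n : ∀ {p m n} → m < p → n < p → + p ∣ + m - + n → m ≡ n
p∣m-n⇒m≡n {p} {m} {n} m<p n<p p∣m-n =
  ℤ.+-injective (ℤ.i-j≡0⇒i≡j (+ m) (+ n) (ℤ.∣i∣≡0⇒i≡0 (multiple-below (∣⇒∣ᵤ p∣m-n) ∣m-n∣<p)))
  where
  ∣m-n∣<p : ∣ + m - + n ∣ < p
  ∣m-n∣<p = ℕ.≤-<-trans (subst (ℕ._≤ m ℕ.⊔ n) (cong ∣_∣ (sym (ℤ.[+m]-[+n]≡m⊖n m n))) (ℤ.∣m⊝n∣≤m⊔n m n))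
                        (ℕ.⊔-lub m<p n<p)
  multiple-below : ∀ {d} → p ∣ₙ d → d < p → d ≡ 0
  multiple-below {zero} _ _ = refl
  multiple-below {suc d} p∣d d<p = contradiction p∣d (ℕ∣.>⇒∤ d<p)

∣-linComb-cross : ∀ {p n a b} {v u w : Vec ℤ n} →
  VecCong p u (scale a v) → VecCong p w (scale b v) → All (+ p ∣_) (linComb b (- a) u w)
∣-linComb-cross {v = []} [] [] = []
∣-linComb-cross {p} {a = a} {b} {x ∷ _} {y ∷ _} {z ∷ _} (y≡ax ∷ u≡av) (z≡bx ∷ w≡bv) =
  subst (+ p ∣_) (sym (cross a b x y z))
    (∣m∣n⇒∣m+n (∣n⇒∣m*n b (∣ᵤ⇒∣ {i = y - a * x} y≡ax)) (∣n⇒∣m*n (- a) (∣ᵤ⇒∣ {i = z - b * x} z≡bx)))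
  ∷ ∣-linComb-cross {a = a} {b} u≡av w≡bv
  where
  cross : ∀ a b x y z → b * y + - a * z ≡ b * (y - a * x) + - a * (z - b * x)
  cross = solve-∀

∣-all⇒*∣dot-self : ∀ {n} d {z : Vec ℤ n} → All (d ∣_) z → d * d ∣ dot z z
∣-all⇒*∣dot-self d [] = divides (+ 0) refl
∣-all⇒*∣dot-self d (divides q refl ∷ d∣z) =
  ∣m∣n⇒∣m+n (divides (q * q) (square q d)) (∣-all⇒*∣dot-self d d∣z)
  where
  square : ∀ q d → q * d * (q * d) ≡ q * q * (d * d)
  square = solve-∀

perfectReps-p*p∣dot : ∀ {p n c₁ c₂} {v u w : Vec ℤ n} → Prime p → ¬ p ∣ₙ 2 → ¬ p ∣ₙ c₁ → ¬ p ∣ₙ c₂ →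
  PerfectRep p (scale (+ c₁) v) u → PerfectRep p (scale (+ c₂) v) w → + (p ℕ.* p) ∣ dot u w
perfectReps-p*p∣dot {p} {c₁ = c₁} {c₂} {u = u} {w} pr p∤2 p∤c₁ p∤c₂ (u≡c₁v , _ , uu) (w≡c₂v , _ , ww) =
  ∣ᵤ⇒∣ (p*p∣m*n⇒p*p∣n pr (prime∤* pr (prime∤* pr p∤2 p∤c₂) p∤c₁)
                          (subst (p ℕ.* p ∣ₙ_) ∣MK∣≡ (∣⇒∣ᵤ P²∣MK)))
  where
  P² = + (p ℕ.* p)
  C₁ = + c₁
  C₂ = + c₂
  M = + 2 * C₂ * C₁
  K = dot u w
  X = linComb C₂ (- C₁) u w
  P²∣‖X‖² : P² ∣ dot X X
  P²∣‖X‖² = subst (_∣ dot X X) (sym (ℤ.pos-* p p))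
              (∣-all⇒*∣dot-self (+ p) (∣-linComb-cross {a = C₁} {C₂} u≡c₁v w≡c₂v))
  ‖X‖² : dot X X ≡ C₂ * C₂ * P² + + 2 * C₂ * - C₁ * K + - C₁ * - C₁ * P²
  ‖X‖² = trans (dot-linComb-self C₂ (- C₁) u w)
               (cong₂ (λ U W → C₂ * C₂ * U + + 2 * C₂ * - C₁ * K + - C₁ * - C₁ * W) uu ww)
  isolate : ∀ C₁ C₂ Q K →
    (C₂ * C₂ + C₁ * C₁) * Q - (C₂ * C₂ * Q + + 2 * C₂ * - C₁ * K + - C₁ * - C₁ * Q) ≡ + 2 * C₂ * C₁ * K
  isolate = solve-∀
  P²∣MK : P² ∣ M * K
  P²∣MK = subst (P² ∣_) (isolate C₁ C₂ P² K)
            (∣m∣n⇒∣m-n (∣n⇒∣m*n (C₂ * C₂ + C₁ * C₁) ∣-refl) (subst (P² ∣_) ‖X‖² P²∣‖X‖²))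
  ∣MK∣≡ : ∣ M * K ∣ ≡ 2 ℕ.* c₂ ℕ.* c₁ ℕ.* ∣ K ∣
  ∣MK∣≡ = trans (ℤ.abs-* M K)
                (cong (ℕ._* ∣ K ∣) (trans (ℤ.abs-* (+ 2 * C₂) C₁) (cong (ℕ._* c₁) (ℤ.abs-* (+ 2) C₂))))

perfectReps-orthogonal : ∀ {p n c₁ c₂} {v u w : Vec ℤ n} → Prime p → ¬ p ∣ₙ 2 → ¬ p ∣ₙ c₁ → ¬ p ∣ₙ c₂ →
  PerfectRep p (scale (+ c₁) v) u → PerfectRep p (scale (+ c₂) v) w → u ≢ w → dot u w ≡ + 0
perfectReps-orthogonal {p} {n} {u = u} {w} pr p∤2 p∤c₁ p∤c₂ ru@(_ , u·e≡p , uu) rw@(_ , w·e≡p , ww) u≢w =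
  exclude (equalNorms-∣dot⇒orthogonal⊎equal⊎opposite (p ℕ.* p) u w uu ww
             (perfectReps-p*p∣dot pr p∤2 p∤c₁ p∤c₂ ru rw))
  where
  e = ones n
  exclude : dot u w ≡ + 0 ⊎ u ≡ w ⊎ All (_≡ + 0) (linComb (+ 1) (+ 1) u w) → dot u w ≡ + 0
  exclude (inj₁ u⊥w) = u⊥w
  exclude (inj₂ (inj₁ u≡w)) = contradiction u≡w u≢w
  exclude (inj₂ (inj₂ u+w≡0)) =
    contradiction (ℕ.m+n≡0⇒m≡0 p (ℤ.+-injective p+p≡0)) (ℕ.≢-nonZero⁻¹ p {{prime⇒nonZero pr}})
    where
    open ≡-Reasoning
    p+p≡0 : + p + + p ≡ + 0
    p+p≡0 = begin
      + p + + p                        ≡⟨ cong₂ _+_ u·e≡p w·e≡p ⟨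
      dot u e + dot w e                ≡⟨ cong₂ _+_ (ℤ.*-identityˡ (dot u e)) (ℤ.*-identityˡ (dot w e)) ⟨
      + 1 * dot u e + + 1 * dot w e    ≡⟨ dot-linCombˡ (+ 1) (+ 1) u w e ⟨
      dot (linComb (+ 1) (+ 1) u w) e  ≡⟨ dot-zeroˡ u+w≡0 e ⟩
      + 0                              ∎

perfectReps-distinct : ∀ {p n c₁ c₂} {v w₁ w₂ : Vec ℤ n} → Prime p → c₁ < p → c₂ < p → c₁ ≢ c₂ →
  EntriesNonzeroMod p v → PerfectRep p (scale (+ c₁) v) w₁ → PerfectRep p (scale (+ c₂) v) w₂ → w₁ ≢ w₂
perfectReps-distinct {p} {v = []} {[]} pr _ _ _ _ (_ , 0≡p , _) _ refl =
  ℕ.≢-nonZero⁻¹ p {{prime⇒nonZero pr}} (sym (ℤ.+-injective 0≡p))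
perfectReps-distinct {p} {c₁ = c₁} {c₂} {x ∷ _} {a ∷ _} pr c₁<p c₂<p c₁≢c₂
                     (p∤x ∷ _) (a≡c₁x ∷ _ , _) (a≡c₂x ∷ _ , _) refl =
  [ c₁≢c₂ ∘ p∣m-n⇒m≡n c₁<p c₂<p , p∤x ∘ ∣⇒∣ᵤ ]′ (euclidsLemma-ℤ (+ c₁ - + c₂) x pr p∣[c₁-c₂]x)
  where
  difference : ∀ a x c₁ c₂ → (a - c₂ * x) - (a - c₁ * x) ≡ (c₁ - c₂) * x
  difference = solve-∀
  p∣[c₁-c₂]x : + p ∣ (+ c₁ - + c₂) * x
  p∣[c₁-c₂]x = subst (+ p ∣_) (difference a x (+ c₁) (+ c₂))
    (∣m∣n⇒∣m-n (∣ᵤ⇒∣ {i = a - + c₂ * x} a≡c₂x) (∣ᵤ⇒∣ {i = a - + c₁ * x} a≡c₁x))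

proposition3p3 : (p n : ℕ) → Prime p → p ≢ 2 → (v : Vec ℤ n) → EntriesNonzeroMod p v →
    (c₁ c₂ : ℕ) → 1 ≤ c₁ → c₁ < p → 1 ≤ c₂ → c₂ < p → c₁ ≢ c₂ →
    ((u₁ u₂ : Vec ℤ n) → PerfectRep p (scale (+ c₁) v) u₁ → PerfectRep p (scale (+ c₁) v) u₂ →
      u₁ ≢ u₂ → dot u₁ u₂ ≡ + 0)
    × ((w₁ w₂ : Vec ℤ n) → PerfectRep p (scale (+ c₁) v) w₁ → PerfectRep p (scale (+ c₂) v) w₂ →
      (w₁ ≢ w₂) × (dot w₁ w₂ ≡ + 0))
proposition3p3 p n pr p≢2 v v≢0 c₁ c₂ 1≤c₁ c₁<p 1≤c₂ c₂<p c₁≢c₂ =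
  (λ _ _ r₁ r₂ → perfectReps-orthogonal pr p∤2 p∤c₁ p∤c₁ r₁ r₂) ,
  λ _ _ r₁ r₂ → let w₁≢w₂ = perfectReps-distinct pr c₁<p c₂<p c₁≢c₂ v≢0 r₁ r₂
                in w₁≢w₂ , perfectReps-orthogonal pr p∤2 p∤c₁ p∤c₂ r₁ r₂ w₁≢w₂
  where
  p∤2 : ¬ p ∣ₙ 2
  p∤2 = ∤-below (s≤s z≤n) (ℕ.≤∧≢⇒< (ℕ.nonTrivial⇒n>1 p {{prime⇒nonTrivial pr}}) (≢-sym p≢2))
  p∤c₁ : ¬ p ∣ₙ c₁
  p∤c₁ = ∤-below 1≤c₁ c₁<p
  p∤c₂ : ¬ p ∣ₙ c₂
  p∤c₂ = ∤-below 1≤c₂ c₂<p
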